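{- Let $s\in\{0,1\}^n$ contain $a$ zeros and $b$ ones. Let $\alpha^*$ be the smallest integer $\alpha$ such that there exists a BST on keys $1,\dots,n$ with $0$-regret $\alpha$ and $1$-regret $0$. Then $\alpha^*\le a\lfloor\log_2(b+2)\rfloor$.
   Context: The string $s$ assigns key $i\in\{1,\dots,n\}$ to scenario $s_i\in\{0,1\}$; keys with $s_i=c$ are the $c$-keys. In a binary search tree on keys $1,\dots,n$, the cost of a key is its level (root at level 1). The $c$-cost of a tree is the sum of the costs of all $c$-keys. $\mathrm{OPT}(m)$ denotes the minimum, over all binary search trees on $m$ keys, of the sum of the levels of all keys (it equals $(m+1)\lceil\log_2(m+1)\rceil-2^{\lceil\log_2(m+1)\rceil}+1$). The $0$-regret of a tree is its $0$-cost minus $\mathrm{OPT}(a)$, and its $1$-regret is its $1$-cost minus $\mathrm{OPT}(b)$. -}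

module Defs where

open import Data.Nat using (ℕ; zero; suc; _+_; _≤_)
open import Data.Bool using (Bool; true; false; if_then_else_)
open import Data.List using (List; []; _∷_; _++_; map)
open import Data.Nat.ListAction using (sum)
open import Data.Vec using (Vec; toList; countᵇ)
open import Data.Product using (Σ; _×_; ∃-syntax)
open import Relation.Binary.PropositionalEquality using (_≡_)
open import Function using (id)

-- Binary search trees on keys 1..m, represented by their shape:
-- a tree with l nodes in the left subtree has root key (offset + l + 1);
-- keys are assigned in in-order (symmetric) order, which is the unique
-- BST labelling of a shape by the keys 1..m.
data BST : ℕ → Set where
  leaf : BST zero
  node : ∀ {l r} → BST l → BST r → BST (suc (l + r))

levels : ∀ {m} → BST m → List ℕ
levels leaf       = []
levels (node l r) = map suc (levels l) ++ (1 ∷ map suc (levels r))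

totalCost : ∀ {m} → BST m → ℕ
totalCost t = sum (levels t)

_==_ : Bool → Bool → Bool
true == true = true
false == false = true
_ == _ = false

-- scenario bits: 0 = false, 1 = true.
-- sum of the entries of the second list whose matching bit equals c
costWith : Bool → List Bool → List ℕ → ℕ
costWith c (x ∷ xs) (v ∷ vs) = (if x == c then v else 0) + costWith c xs vs
costWith c _ _ = 0

cCost : ∀ {n} → Vec Bool n → Bool → BST n → ℕ
cCost s c t = costWith c (toList s) (levels t)

countScen : ∀ {n} → Bool → Vec Bool n → ℕ
countScen c s = countᵇ (λ x → x == c) s

IsOPT : ℕ → ℕ → Set
IsOPT m v = (∃[ t ] totalCost {m} t ≡ v) × (∀ (t : BST m) → v ≤ totalCost t)

-- Interleave an optimal tree T on the 1-keys with an optimal tree U on the 0-keys: the 1-keys keep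
-- their levels in T, and the 0-keys fall into the b + 1 gaps between consecutive 1-keys, which hang
-- below T. At a node of T both sides are pushed one level down; splitting U between the two sides
-- lifts the side without the root of U and so pays for the lighter side, while the heavier side costs
-- its number of 0-keys. Hence the 0-regret is at most the sum over the nodes of T of the mass of the
-- heavier side. Take for T a complete tree of height k = ⌊log₂ (b + 1)⌋ (which is optimal); this sum
-- is at most (k − 1) a plus the mass of the heaviest bottom slot plus the overhead of the bottom keys,
-- and placing the bottom keys so that the heaviest gap lies below an empty bottom slot makes the last
-- two terms add up to at most a. If there are not two empty bottom slots, then b + 2 = 2^(k+1) and the
-- cruder bound (k + 1) a suffices.

module Submission where

open import Defs
open import Data.Bool using (Bool; true; false; if_then_else_)
open import Data.List using (List; []; _∷_; _++_; map; length; take; drop; replicate; foldr)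
open import Data.List.Properties
  using (length-map; length-++; length-take; length-drop; take++drop≡id; length-replicate)
open import Data.List.Relation.Unary.All as All using (All; []; _∷_)
open import Data.List.Relation.Unary.All.Properties using (++⁺; take⁺; drop⁺)
open import Data.List.Relation.Unary.Any using (here; there)
open import Data.List.Membership.Propositional using (_∈_)
open import Data.List.Membership.Propositional.Properties using (∈-∃++)
open import Data.Nat using (ℕ; zero; suc; _+_; _*_; _∸_; _^_; _≤_; _<_; _⊔_; _⊓_; z≤n; s≤s; z<s; _≤?_; _<?_)
open import Data.Nat.ListAction using (sum)
open import Data.Nat.ListAction.Properties using (sum-++)
open import Data.Nat.Logarithm using (⌊log₂_⌋; ⌊log₂⌋-mono-≤; ⌊log₂[2^n]⌋≡n)
open import Data.Nat.Properties
open import Data.Nat.Tactic.RingSolver using (solve-∀)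
open import Data.List.Extrema ≤-totalOrder using (max; xs≤max; v≤max⁺; argmax-sel)
open import Data.Product using (Σ; _×_; _,_; ∃-syntax)
open import Data.Sum using (_⊎_; inj₁; inj₂)
open import Data.Vec as Vec using (Vec; toList)
open import Data.Vec.Properties using (length-toList)
open import Relation.Binary.PropositionalEquality
open import Relation.Nullary using (Dec; yes; no)

count : Bool → List Bool → ℕ
count c []       = 0
count c (x ∷ xs) = (if x == c then 1 else 0) + count c xs

ones zeros : List Bool → ℕ
ones  = count true
zeros = count false

count-++ : ∀ c xs ys → count c (xs ++ ys) ≡ count c xs + count c ys
count-++ c []       ys = refl
count-++ c (x ∷ xs) ys =
  trans (cong ((if x == c then 1 else 0) +_) (count-++ c xs ys))
        (sym (+-assoc (if x == c then 1 else 0) (count c xs) (count c ys)))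

length≡ones+zeros : ∀ xs → length xs ≡ ones xs + zeros xs
length≡ones+zeros []           = refl
length≡ones+zeros (true ∷ xs)  = cong suc (length≡ones+zeros xs)
length≡ones+zeros (false ∷ xs) =
  trans (cong suc (length≡ones+zeros xs)) (sym (+-suc (ones xs) (zeros xs)))

countScen≡count : ∀ c {n} (s : Vec Bool n) → countScen c s ≡ count c (toList s)
countScen≡count c     Vec.[]          = refl
countScen≡count true  (true  Vec.∷ s) = cong suc (countScen≡count true s)
countScen≡count true  (false Vec.∷ s) = countScen≡count true s
countScen≡count false (true  Vec.∷ s) = countScen≡count false s
countScen≡count false (false Vec.∷ s) = cong suc (countScen≡count false s)

cast : ∀ {m n} → m ≡ n → BST m → BST n
cast refl t = t

levels-cast : ∀ {m n} (e : m ≡ n) (t : BST m) → levels (cast e t) ≡ levels t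
levels-cast refl t = refl

totalCost-cast : ∀ {m n} (e : m ≡ n) (t : BST m) → totalCost (cast e t) ≡ totalCost t
totalCost-cast e t = cong sum (levels-cast e t)

length-levels : ∀ {m} (t : BST m) → length (levels t) ≡ m
length-levels leaf = refl
length-levels (node {l} {r} tl tr) = begin
  length (map suc (levels tl) ++ 1 ∷ map suc (levels tr))
    ≡⟨ length-++ (map suc (levels tl)) ⟩
  length (map suc (levels tl)) + suc (length (map suc (levels tr)))
    ≡⟨ cong₂ (λ x y → x + suc y) (trans (length-map suc (levels tl)) (length-levels tl))
                                  (trans (length-map suc (levels tr)) (length-levels tr)) ⟩
  l + suc r
    ≡⟨ +-suc l r ⟩
  suc (l + r) ∎
  where open ≡-Reasoning

sum-map-suc : ∀ vs → sum (map suc vs) ≡ length vs + sum vs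
sum-map-suc []       = refl
sum-map-suc (v ∷ vs) = trans (cong (suc v +_) (sum-map-suc vs)) (shuffle v (length vs) (sum vs))
  where
  shuffle : ∀ a b c → suc a + (b + c) ≡ suc b + (a + c)
  shuffle = solve-∀

totalCost-node : ∀ {l r} (tl : BST l) (tr : BST r) →
  totalCost (node tl tr) ≡ (l + totalCost tl) + suc (r + totalCost tr)
totalCost-node {l} {r} tl tr = begin
  sum (map suc (levels tl) ++ 1 ∷ map suc (levels tr))
    ≡⟨ sum-++ (map suc (levels tl)) (1 ∷ map suc (levels tr)) ⟩
  sum (map suc (levels tl)) + suc (sum (map suc (levels tr)))
    ≡⟨ cong₂ (λ x y → x + suc y) (shift tl) (shift tr) ⟩
  (l + totalCost tl) + suc (r + totalCost tr) ∎
  where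
  open ≡-Reasoning
  shift : ∀ {m} (t : BST m) → sum (map suc (levels t)) ≡ m + totalCost t
  shift t = trans (sum-map-suc (levels t)) (cong (_+ totalCost t) (length-levels t))

costWith-++ : ∀ c xs ys (vs ws : List ℕ) → length xs ≡ length vs →
  costWith c (xs ++ ys) (vs ++ ws) ≡ costWith c xs vs + costWith c ys ws
costWith-++ c []       ys []       ws e = refl
costWith-++ c (x ∷ xs) ys (v ∷ vs) ws e =
  trans (cong ((if x == c then v else 0) +_) (costWith-++ c xs ys vs ws (suc-injective e)))
        (sym (+-assoc (if x == c then v else 0) (costWith c xs vs) (costWith c ys ws)))

costWith-map-suc : ∀ c xs (vs : List ℕ) → length xs ≡ length vs →
  costWith c xs (map suc vs) ≡ count c xs + costWith c xs vs
costWith-map-suc c []       []       e = refl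
costWith-map-suc c (x ∷ xs) (v ∷ vs) e with x == c
... | true  = cong suc (trans (cong (v +_) (costWith-map-suc c xs vs (suc-injective e)))
                              (shuffle v (count c xs) (costWith c xs vs)))
  where
  shuffle : ∀ a b d → a + (b + d) ≡ b + (a + d)
  shuffle = solve-∀
... | false = costWith-map-suc c xs vs (suc-injective e)

costWith≤sum : ∀ c xs (vs : List ℕ) → costWith c xs vs ≤ sum vs
costWith≤sum c []       vs       = z≤n
costWith≤sum c (x ∷ xs) []       = z≤n
costWith≤sum c (x ∷ xs) (v ∷ vs) with x == c
... | true  = +-monoʳ-≤ v (costWith≤sum c xs vs)
... | false = ≤-trans (costWith≤sum c xs vs) (m≤n+m (sum vs) v)

costWith-absent : ∀ c xs (vs : List ℕ) → count c xs ≡ 0 → costWith c xs vs ≡ 0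
costWith-absent c []       vs       e = refl
costWith-absent c (x ∷ xs) []       e = refl
costWith-absent c (x ∷ xs) (v ∷ vs) e with x == c
... | false = costWith-absent c xs vs e

suc-+-cancelˡ : ∀ p {d y q} → suc (p + d) + y ≡ suc (p + q) → d + y ≡ q
suc-+-cancelˡ p {d} {y} e = +-cancelˡ-≡ p _ _ (trans (sym (+-assoc p d y)) (suc-injective e))

-- The part not containing the root of t moves up a level, which saves at least x ⊓ y.
splitBST : ∀ {m} x y (t : BST m) → x + y ≡ m →
  Σ (BST x) λ t₁ → Σ (BST y) λ t₂ → totalCost t₁ + totalCost t₂ + x ⊓ y ≤ totalCost t
splitNode-left : ∀ {p q} x y (l : BST p) (r : BST q) → x + y ≡ suc (p + q) → x ≤ p →
  Σ (BST x) λ t₁ → Σ (BST y) λ t₂ → totalCost t₁ + totalCost t₂ + x ⊓ y ≤ totalCost (node l r)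
splitNode-right : ∀ {p q} x y (l : BST p) (r : BST q) → x + y ≡ suc (p + q) → p < x →
  Σ (BST x) λ t₁ → Σ (BST y) λ t₂ → totalCost t₁ + totalCost t₂ + x ⊓ y ≤ totalCost (node l r)

splitBST zero    zero    leaf refl = leaf , leaf , z≤n
splitBST (suc x) y       leaf ()
splitBST zero    (suc y) leaf ()
splitBST x y (node {p} {q} l r) e with x ≤? p
... | yes x≤p = splitNode-left x y l r e x≤p
... | no  x≰p = splitNode-right x y l r e (≰⇒> x≰p)

splitNode-left {q = q} x y l r e x≤p with m≤n⇒∃[o]m+o≡n x≤p
... | d , refl with splitBST x d l refl
... | l₁ , l₂ , split-l = l₁ , cast 1+d+q≡y (node l₂ r) , bound
  where
  open ≤-Reasoning
  C = totalCost
  1+d+q≡y : suc (d + q) ≡ y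
  1+d+q≡y = +-cancelˡ-≡ x _ _ (trans (+-suc x (d + q)) (trans (cong suc (sym (+-assoc x d q))) (sym e)))
  shuffle : ∀ a b c u v → a + ((b + c) + u) + v ≡ (a + c) + (v + b) + u
  shuffle = solve-∀
  bound : C l₁ + C (cast 1+d+q≡y (node l₂ r)) + x ⊓ y ≤ C (node l r)
  bound = begin
    C l₁ + C (cast 1+d+q≡y (node l₂ r)) + x ⊓ y
      ≤⟨ +-monoʳ-≤ (C l₁ + C (cast 1+d+q≡y (node l₂ r))) (m⊓n≤m x y) ⟩
    C l₁ + C (cast 1+d+q≡y (node l₂ r)) + x
      ≡⟨ cong (λ c → C l₁ + c + x) (trans (totalCost-cast 1+d+q≡y (node l₂ r)) (totalCost-node l₂ r)) ⟩
    C l₁ + ((d + C l₂) + suc (q + C r)) + x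
      ≡⟨ shuffle (C l₁) d (C l₂) (suc (q + C r)) x ⟩
    (C l₁ + C l₂) + (x + d) + suc (q + C r)
      ≤⟨ +-monoˡ-≤ (suc (q + C r)) (+-monoˡ-≤ (x + d) (m+n≤o⇒m≤o (C l₁ + C l₂) split-l)) ⟩
    C l + (x + d) + suc (q + C r)
      ≡⟨ cong (_+ suc (q + C r)) (+-comm (C l) (x + d)) ⟩
    (x + d) + C l + suc (q + C r)
      ≡⟨ totalCost-node l r ⟨
    C (node l r) ∎
splitNode-right {p} {q} x y l r e p<x with m≤n⇒∃[o]m+o≡n p<x
... | d , refl with splitBST d y r (suc-+-cancelˡ p e)
... | r₁ , r₂ , split-r = node l r₁ , r₂ , bound
  where
  open ≤-Reasoning
  C = totalCost
  d+y≡q : d + y ≡ q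
  d+y≡q = suc-+-cancelˡ p e
  shuffle : ∀ a b c u v → (a + suc (b + c)) + u + v ≡ a + suc ((c + u) + (b + v))
  shuffle = solve-∀
  bound : C (node l r₁) + C r₂ + suc (p + d) ⊓ y ≤ C (node l r)
  bound = begin
    C (node l r₁) + C r₂ + suc (p + d) ⊓ y
      ≤⟨ +-monoʳ-≤ (C (node l r₁) + C r₂) (m⊓n≤n (suc (p + d)) y) ⟩
    C (node l r₁) + C r₂ + y
      ≡⟨ cong (λ c → c + C r₂ + y) (totalCost-node l r₁) ⟩
    (p + C l) + suc (d + C r₁) + C r₂ + y
      ≡⟨ shuffle (p + C l) d (C r₁) (C r₂) y ⟩
    (p + C l) + suc ((C r₁ + C r₂) + (d + y))
      ≡⟨ cong (λ n → (p + C l) + suc ((C r₁ + C r₂) + n)) d+y≡q ⟩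
    (p + C l) + suc ((C r₁ + C r₂) + q)
      ≤⟨ +-monoʳ-≤ (p + C l) (s≤s (+-monoˡ-≤ q (m+n≤o⇒m≤o (C r₁ + C r₂) split-r))) ⟩
    (p + C l) + suc (C r + q)
      ≡⟨ cong (λ n → (p + C l) + suc n) (+-comm (C r) q) ⟩
    (p + C l) + suc (q + C r)
      ≡⟨ totalCost-node l r ⟨
    C (node l r) ∎

take-length-++ : ∀ {A : Set} (xs ys : List A) → take (length xs) (xs ++ ys) ≡ xs
take-length-++ []       ys = refl
take-length-++ (x ∷ xs) ys = cong (x ∷_) (take-length-++ xs ys)

drop-length-++ : ∀ {A : Set} (xs ys : List A) → drop (length xs) (xs ++ ys) ≡ ys
drop-length-++ []       ys = refl
drop-length-++ (x ∷ xs) ys = drop-length-++ xs ys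

m⊓n+m⊔n≡m+n : ∀ m n → m ⊓ n + (m ⊔ n) ≡ m + n
m⊓n+m⊔n≡m+n m n with ≤-total m n
... | inj₁ m≤n = cong₂ _+_ (m≤n⇒m⊓n≡m m≤n) (m≤n⇒m⊔n≡n m≤n)
... | inj₂ n≤m = trans (cong₂ _+_ (m≥n⇒m⊓n≡n n≤m) (m≥n⇒m⊔n≡m n≤m)) (+-comm n m)

gapsFrom : ℕ → List Bool → List ℕ
gapsFrom k []          = k ∷ []
gapsFrom k (true ∷ s)  = k ∷ gapsFrom 0 s
gapsFrom k (false ∷ s) = gapsFrom (suc k) s

gaps : List Bool → List ℕ
gaps = gapsFrom 0

length-gapsFrom : ∀ k s → length (gapsFrom k s) ≡ suc (ones s)
length-gapsFrom k []          = refl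
length-gapsFrom k (true ∷ s)  = cong suc (length-gapsFrom 0 s)
length-gapsFrom k (false ∷ s) = length-gapsFrom (suc k) s

sum-gapsFrom : ∀ k s → sum (gapsFrom k s) ≡ k + zeros s
sum-gapsFrom k []          = refl
sum-gapsFrom k (true ∷ s)  = cong (k +_) (sum-gapsFrom 0 s)
sum-gapsFrom k (false ∷ s) = trans (sum-gapsFrom (suc k) s) (sym (+-suc k (zeros s)))

gapsFrom-++ : ∀ k s s′ → gapsFrom k (s ++ true ∷ s′) ≡ gapsFrom k s ++ gaps s′
gapsFrom-++ k []          s′ = refl
gapsFrom-++ k (true ∷ s)  s′ = cong (k ∷_) (gapsFrom-++ 0 s s′)
gapsFrom-++ k (false ∷ s) s′ = gapsFrom-++ (suc k) s s′

splitAtOne : ∀ s l r → ones s ≡ suc (l + r) →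
  Σ (List Bool) λ sL → Σ (List Bool) λ sR → (s ≡ sL ++ true ∷ sR) × (ones sL ≡ l) × (ones sR ≡ r)
splitAtOne []          l       r ()
splitAtOne (false ∷ s) l       r e with splitAtOne s l r e
... | sL , sR , refl , eL , eR = false ∷ sL , sR , refl , eL , eR
splitAtOne (true ∷ s)  zero    r e = [] , s , refl , refl , suc-injective e
splitAtOne (true ∷ s)  (suc l) r e with splitAtOne s l r (suc-injective e)
... | sL , sR , refl , eL , eR = true ∷ sL , sR , refl , cong suc eL , eR

-- When the 1-keys are arranged by T and cs lists the numbers of 0-keys in the gaps between
-- consecutive 1-keys, every node of T pushes the 0-keys on its heavier side one level down.
overhead : ∀ {b} → BST b → List ℕ → ℕ
overhead leaf             cs = 0
overhead (node {l} tl tr) cs =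
  (sum (take (suc l) cs) ⊔ sum (drop (suc l) cs)) + overhead tl (take (suc l) cs) + overhead tr (drop (suc l) cs)

overhead-cast : ∀ {m n} (e : m ≡ n) (T : BST m) cs → overhead (cast e T) cs ≡ overhead T cs
overhead-cast refl T cs = refl

overhead-node-gaps : ∀ {l r} (TL : BST l) (TR : BST r) sL sR → ones sL ≡ l →
  overhead (node TL TR) (gaps (sL ++ true ∷ sR))
    ≡ (zeros sL ⊔ zeros sR) + overhead TL (gaps sL) + overhead TR (gaps sR)
overhead-node-gaps TL TR sL sR refl = begin
  overhead (node TL TR) (gaps (sL ++ true ∷ sR))
    ≡⟨ cong (overhead (node TL TR)) (gapsFrom-++ 0 sL sR) ⟩
  overhead (node TL TR) (gaps sL ++ gaps sR)
    ≡⟨ cong₂ (λ xs ys → (sum xs ⊔ sum ys) + overhead TL xs + overhead TR ys)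
             (trans (cong (λ n → take n (gaps sL ++ gaps sR)) (sym len)) (take-length-++ (gaps sL) (gaps sR)))
             (trans (cong (λ n → drop n (gaps sL ++ gaps sR)) (sym len)) (drop-length-++ (gaps sL) (gaps sR))) ⟩
  (sum (gaps sL) ⊔ sum (gaps sR)) + overhead TL (gaps sL) + overhead TR (gaps sR)
    ≡⟨ cong₂ (λ x y → (x ⊔ y) + overhead TL (gaps sL) + overhead TR (gaps sR))
             (sum-gapsFrom 0 sL) (sum-gapsFrom 0 sR) ⟩
  (zeros sL ⊔ zeros sR) + overhead TL (gaps sL) + overhead TR (gaps sR) ∎
  where
  open ≡-Reasoning
  len : length (gaps sL) ≡ suc (ones sL)
  len = length-gapsFrom 0 sL

costWith-node : ∀ c sL sR (tL : BST (length sL)) (tR : BST (length sR)) →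
  costWith c (sL ++ true ∷ sR) (levels (node tL tR))
    ≡ (count c sL + costWith c sL (levels tL))
      + ((if true == c then 1 else 0) + (count c sR + costWith c sR (levels tR)))
costWith-node c sL sR tL tR = begin
  costWith c (sL ++ true ∷ sR) (map suc (levels tL) ++ 1 ∷ map suc (levels tR))
    ≡⟨ costWith-++ c sL (true ∷ sR) (map suc (levels tL)) _
         (trans (sym (length-levels tL)) (sym (length-map suc (levels tL)))) ⟩
  costWith c sL (map suc (levels tL)) + ((if true == c then 1 else 0) + costWith c sR (map suc (levels tR)))
    ≡⟨ cong₂ (λ x y → x + ((if true == c then 1 else 0) + y))
             (costWith-map-suc c sL (levels tL) (sym (length-levels tL)))
             (costWith-map-suc c sR (levels tR) (sym (length-levels tR))) ⟩
  (count c sL + costWith c sL (levels tL))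
    + ((if true == c then 1 else 0) + (count c sR + costWith c sR (levels tR))) ∎
  where open ≡-Reasoning

-- Both sides lose a level; splitting U pays for the lighter side, the overhead for the heavier.
node-cost-bound : ∀ {zL zR cL cR uL uR u oL oR} → cL ≤ uL + oL → cR ≤ uR + oR → uL + uR + zL ⊓ zR ≤ u →
  (zL + cL) + (zR + cR) ≤ u + ((zL ⊔ zR) + oL + oR)
node-cost-bound {zL} {zR} {cL} {cR} {uL} {uR} {u} {oL} {oR} boundL boundR split = begin
  (zL + cL) + (zR + cR)                         ≡⟨ shuffle₁ zL cL zR cR ⟩
  (zL + zR) + (cL + cR)                         ≡⟨ cong (_+ (cL + cR)) (m⊓n+m⊔n≡m+n zL zR) ⟨
  (zL ⊓ zR + (zL ⊔ zR)) + (cL + cR)             ≤⟨ +-monoʳ-≤ (zL ⊓ zR + (zL ⊔ zR)) (+-mono-≤ boundL boundR) ⟩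
  (zL ⊓ zR + (zL ⊔ zR)) + ((uL + oL) + (uR + oR)) ≡⟨ shuffle₂ (zL ⊓ zR) (zL ⊔ zR) uL oL uR oR ⟩
  (uL + uR + zL ⊓ zR) + ((zL ⊔ zR) + oL + oR)   ≤⟨ +-monoˡ-≤ ((zL ⊔ zR) + oL + oR) split ⟩
  u + ((zL ⊔ zR) + oL + oR) ∎
  where
  open ≤-Reasoning
  shuffle₁ : ∀ a b c d → (a + b) + (c + d) ≡ (a + c) + (b + d)
  shuffle₁ = solve-∀
  shuffle₂ : ∀ m M a b c d → (m + M) + ((a + b) + (c + d)) ≡ (a + c + m) + (M + b + d)
  shuffle₂ = solve-∀

merge : ∀ {b} (T : BST b) s → ones s ≡ b → (U : BST (zeros s)) →
  Σ (BST (length s)) λ t → (costWith true s (levels t) ≡ totalCost T)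
                         × (costWith false s (levels t) ≤ totalCost U + overhead T (gaps s))
merge leaf s e U = cast zeros≡length U , costWith-absent true s _ e , cost₀
  where
  zeros≡length : zeros s ≡ length s
  zeros≡length = sym (trans (length≡ones+zeros s) (cong (_+ zeros s) e))
  cost₀ : costWith false s (levels (cast zeros≡length U)) ≤ totalCost U + 0
  cost₀ = ≤-trans (costWith≤sum false s _)
                  (≤-reflexive (trans (totalCost-cast zeros≡length U) (sym (+-identityʳ _))))
merge (node {l} {r} TL TR) s e U with splitAtOne s l r e
... | sL , sR , refl , eL , eR
    with splitBST (zeros sL) (zeros sR) U (sym (count-++ false sL (true ∷ sR)))
... | UL , UR , split-U with merge TL sL eL UL | merge TR sR eR UR
... | tL , cost₁L , cost₀L | tR , cost₁R , cost₀R = t , cost₁ , cost₀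
  where
  s′ = sL ++ true ∷ sR
  length-s′ : suc (length sL + length sR) ≡ length s′
  length-s′ = sym (trans (length-++ sL) (+-suc (length sL) (length sR)))
  t = cast length-s′ (node tL tR)
  cost₁ : costWith true s′ (levels t) ≡ totalCost (node TL TR)
  cost₁ = begin
    costWith true s′ (levels t)
      ≡⟨ cong (costWith true s′) (levels-cast length-s′ (node tL tR)) ⟩
    costWith true s′ (levels (node tL tR))
      ≡⟨ costWith-node true sL sR tL tR ⟩
    (ones sL + costWith true sL (levels tL)) + suc (ones sR + costWith true sR (levels tR))
      ≡⟨ cong₂ (λ x y → x + suc y) (cong₂ _+_ eL cost₁L) (cong₂ _+_ eR cost₁R) ⟩
    (l + totalCost TL) + suc (r + totalCost TR)
      ≡⟨ totalCost-node TL TR ⟨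
    totalCost (node TL TR) ∎
    where open ≡-Reasoning
  cost₀ : costWith false s′ (levels t) ≤ totalCost U + overhead (node TL TR) (gaps s′)
  cost₀ = begin
    costWith false s′ (levels t)
      ≡⟨ cong (costWith false s′) (levels-cast length-s′ (node tL tR)) ⟩
    costWith false s′ (levels (node tL tR))
      ≡⟨ costWith-node false sL sR tL tR ⟩
    (zeros sL + costWith false sL (levels tL)) + (zeros sR + costWith false sR (levels tR))
      ≤⟨ node-cost-bound {zeros sL} {zeros sR} cost₀L cost₀R split-U ⟩
    totalCost U + ((zeros sL ⊔ zeros sR) + overhead TL (gaps sL) + overhead TR (gaps sR))
      ≡⟨ cong (totalCost U +_) (overhead-node-gaps TL TR sL sR eL) ⟨
    totalCost U + overhead (node TL TR) (gaps s′) ∎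
    where open ≤-Reasoning

-- The external path length: levels start at 1, so this is the sum of the depths of the m + 1 leaves.
extLength : ∀ {m} → BST m → ℕ
extLength {m} t = totalCost t + m

extLength-node : ∀ {p q} (l : BST p) (r : BST q) →
  extLength (node l r) ≡ extLength l + extLength r + 2 + (p + q)
extLength-node {p} {q} l r = trans (cong (_+ suc (p + q)) (totalCost-node l r)) (shuffle p q (totalCost l) (totalCost r))
  where
  shuffle : ∀ p q a b → (p + a) + suc (q + b) + suc (p + q) ≡ (a + p) + (b + q) + 2 + (p + q)
  shuffle = solve-∀

2+n≤2^[1+n] : ∀ n → 2 + n ≤ 2 ^ suc n
2+n≤2^[1+n] zero    = ≤-refl
2+n≤2^[1+n] (suc n) =
  ≤-trans (+-mono-≤ (m^n>0 2 (suc n)) (2+n≤2^[1+n] n))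
          (≤-reflexive (cong (2 ^ suc n +_) (sym (+-identityʳ (2 ^ suc n)))))

extLength-lowerBound : ∀ k {m} (t : BST m) → suc (suc k) * suc m ≤ extLength t + 2 ^ suc k
extLength-lowerBound k leaf = ≤-trans (≤-reflexive (*-identityʳ (suc (suc k)))) (2+n≤2^[1+n] k)
extLength-lowerBound zero (node {p} {q} l r) = begin
  2 * suc (suc (p + q))                       ≡⟨ shuffle p q ⟩
  p + q + 2 + (p + q) + 2
    ≤⟨ +-monoˡ-≤ 2 (+-monoˡ-≤ (p + q) (+-monoˡ-≤ 2 (+-mono-≤ (m≤n+m p (totalCost l)) (m≤n+m q (totalCost r))))) ⟩
  extLength l + extLength r + 2 + (p + q) + 2 ≡⟨ cong (_+ 2) (extLength-node l r) ⟨
  extLength (node l r) + 2 ∎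
  where
  open ≤-Reasoning
  shuffle : ∀ p q → 2 * suc (suc (p + q)) ≡ p + q + 2 + (p + q) + 2
  shuffle = solve-∀
extLength-lowerBound (suc k) (node {p} {q} l r) = begin
  suc (suc (suc k)) * suc (suc (p + q))
    ≡⟨ shuffle₁ k p q ⟩
  suc (suc k) * suc p + suc (suc k) * suc q + (2 + (p + q))
    ≤⟨ +-monoˡ-≤ (2 + (p + q)) (+-mono-≤ (extLength-lowerBound k l) (extLength-lowerBound k r)) ⟩
  (extLength l + 2 ^ suc k) + (extLength r + 2 ^ suc k) + (2 + (p + q))
    ≡⟨ shuffle₂ (extLength l) (extLength r) (p + q) (2 ^ suc k) ⟩
  extLength l + extLength r + 2 + (p + q) + 2 * 2 ^ suc k
    ≡⟨ cong (_+ 2 ^ suc (suc k)) (extLength-node l r) ⟨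
  extLength (node l r) + 2 ^ suc (suc k) ∎
  where
  open ≤-Reasoning
  shuffle₁ : ∀ k p q → suc (suc (suc k)) * suc (suc (p + q)) ≡ suc (suc k) * suc p + suc (suc k) * suc q + (2 + (p + q))
  shuffle₁ = solve-∀
  shuffle₂ : ∀ a b n w → (a + w) + (b + w) + (2 + n) ≡ a + b + 2 + n + 2 * w
  shuffle₂ = solve-∀

-- complete k gs is the complete tree of height k whose i-th bottom slot carries one more key
-- exactly when the i-th entry of gs (of length 2 ^ k) is true.
completeSize : ℕ → List Bool → ℕ
completeSize zero    []          = 0
completeSize zero    (false ∷ _) = 0
completeSize zero    (true ∷ _)  = 1
completeSize (suc k) gs          = suc (completeSize k (take (2 ^ k) gs) + completeSize k (drop (2 ^ k) gs))

complete : ∀ k gs → BST (completeSize k gs)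
complete zero    []          = leaf
complete zero    (false ∷ _) = leaf
complete zero    (true ∷ _)  = node leaf leaf
complete (suc k) gs          = node (complete k (take (2 ^ k) gs)) (complete k (drop (2 ^ k) gs))

leafCount : List Bool → ℕ
leafCount []           = 0
leafCount (false ∷ gs) = 1 + leafCount gs
leafCount (true ∷ gs)  = 2 + leafCount gs

leafCount-++ : ∀ gs gs′ → leafCount (gs ++ gs′) ≡ leafCount gs + leafCount gs′
leafCount-++ []           gs′ = refl
leafCount-++ (false ∷ gs) gs′ = cong suc (leafCount-++ gs gs′)
leafCount-++ (true ∷ gs)  gs′ = cong (2 +_) (leafCount-++ gs gs′)

leafCount-take-drop : ∀ n gs → leafCount gs ≡ leafCount (take n gs) + leafCount (drop n gs)
leafCount-take-drop n gs = trans (cong leafCount (sym (take++drop≡id n gs))) (leafCount-++ (take n gs) (drop n gs))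

length-take-half : ∀ k (gs : List Bool) → length gs ≡ 2 ^ suc k → length (take (2 ^ k) gs) ≡ 2 ^ k
length-take-half k gs e =
  trans (length-take (2 ^ k) gs) (m≤n⇒m⊓n≡m (≤-trans (m≤m+n (2 ^ k) (2 ^ k + 0)) (≤-reflexive (sym e))))

length-drop-half : ∀ k (gs : List Bool) → length gs ≡ 2 ^ suc k → length (drop (2 ^ k) gs) ≡ 2 ^ k
length-drop-half k gs e = begin
  length (drop (2 ^ k) gs)  ≡⟨ length-drop (2 ^ k) gs ⟩
  length gs ∸ 2 ^ k         ≡⟨ cong (_∸ 2 ^ k) (trans e (cong (2 ^ k +_) (+-identityʳ (2 ^ k)))) ⟩
  2 ^ k + 2 ^ k ∸ 2 ^ k     ≡⟨ m+n∸m≡n (2 ^ k) (2 ^ k) ⟩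
  2 ^ k ∎
  where open ≡-Reasoning

suc-completeSize : ∀ k gs → length gs ≡ 2 ^ k → suc (completeSize k gs) ≡ leafCount gs
suc-completeSize zero    (false ∷ []) e = refl
suc-completeSize zero    (true ∷ [])  e = refl
suc-completeSize (suc k) gs e = begin
  suc (suc (completeSize k gsL + completeSize k gsR))
    ≡⟨ cong suc (+-suc (completeSize k gsL) (completeSize k gsR)) ⟨
  suc (completeSize k gsL) + suc (completeSize k gsR)
    ≡⟨ cong₂ _+_ (suc-completeSize k gsL (length-take-half k gs e))
                 (suc-completeSize k gsR (length-drop-half k gs e)) ⟩
  leafCount gsL + leafCount gsR
    ≡⟨ leafCount-take-drop (2 ^ k) gs ⟨
  leafCount gs ∎
  where
  open ≡-Reasoning
  gsL = take (2 ^ k) gs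
  gsR = drop (2 ^ k) gs

extLength-complete : ∀ k gs → length gs ≡ 2 ^ k →
  extLength (complete k gs) + 2 ^ suc k ≡ suc (suc k) * leafCount gs
extLength-complete zero    (false ∷ []) e = refl
extLength-complete zero    (true ∷ [])  e = refl
extLength-complete (suc k) gs e = begin
  extLength (node tL tR) + 2 ^ suc (suc k)
    ≡⟨ cong (_+ 2 ^ suc (suc k)) (extLength-node tL tR) ⟩
  extLength tL + extLength tR + 2 + (nL + nR) + 2 * 2 ^ suc k
    ≡⟨ shuffle₁ (extLength tL) (extLength tR) nL nR (2 ^ suc k) ⟩
  (extLength tL + 2 ^ suc k) + (extLength tR + 2 ^ suc k) + (suc nL + suc nR)
    ≡⟨ cong₂ (λ x y → x + y + (suc nL + suc nR)) (extLength-complete k gsL eL) (extLength-complete k gsR eR) ⟩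
  suc (suc k) * leafCount gsL + suc (suc k) * leafCount gsR + (suc nL + suc nR)
    ≡⟨ cong₂ (λ x y → suc (suc k) * leafCount gsL + suc (suc k) * leafCount gsR + (x + y))
             (suc-completeSize k gsL eL) (suc-completeSize k gsR eR) ⟩
  suc (suc k) * leafCount gsL + suc (suc k) * leafCount gsR + (leafCount gsL + leafCount gsR)
    ≡⟨ shuffle₂ k (leafCount gsL) (leafCount gsR) ⟩
  suc (suc (suc k)) * (leafCount gsL + leafCount gsR)
    ≡⟨ cong (suc (suc (suc k)) *_) (leafCount-take-drop (2 ^ k) gs) ⟨
  suc (suc (suc k)) * leafCount gs ∎
  where
  open ≡-Reasoning
  gsL = take (2 ^ k) gs
  gsR = drop (2 ^ k) gs
  eL = length-take-half k gs e
  eR = length-drop-half k gs e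
  tL = complete k gsL
  tR = complete k gsR
  nL = completeSize k gsL
  nR = completeSize k gsR
  shuffle₁ : ∀ a b p q w → a + b + 2 + (p + q) + 2 * w ≡ (a + w) + (b + w) + (suc p + suc q)
  shuffle₁ = solve-∀
  shuffle₂ : ∀ k x y → suc (suc k) * x + suc (suc k) * y + (x + y) ≡ suc (suc (suc k)) * (x + y)
  shuffle₂ = solve-∀

-- Complete trees attain the bound extLength-lowerBound.
complete-optimal : ∀ k gs → length gs ≡ 2 ^ k → (t : BST (completeSize k gs)) →
  totalCost (complete k gs) ≤ totalCost t
complete-optimal k gs e t =
  +-cancelʳ-≤ (completeSize k gs) _ _ (+-cancelʳ-≤ (2 ^ suc k) _ _ (begin
    extLength (complete k gs) + 2 ^ suc k      ≡⟨ extLength-complete k gs e ⟩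
    suc (suc k) * leafCount gs                 ≡⟨ cong (suc (suc k) *_) (suc-completeSize k gs e) ⟨
    suc (suc k) * suc (completeSize k gs)      ≤⟨ extLength-lowerBound k t ⟩
    extLength t + 2 ^ suc k ∎))
  where open ≤-Reasoning

maximum : List ℕ → ℕ
maximum = foldr _⊔_ 0

maximum-++ : ∀ xs ys → maximum (xs ++ ys) ≡ maximum xs ⊔ maximum ys
maximum-++ []       ys = refl
maximum-++ (x ∷ xs) ys = trans (cong (x ⊔_) (maximum-++ xs ys)) (sym (⊔-assoc x (maximum xs) (maximum ys)))

maximum≤sum : ∀ xs → maximum xs ≤ sum xs
maximum≤sum []       = z≤n
maximum≤sum (x ∷ xs) = ⊔-lub (m≤m+n x (sum xs)) (≤-trans (maximum≤sum xs) (m≤n+m (sum xs) x))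

maximum+-≤ : ∀ n m xs → All (λ x → x + n ≤ m) xs → n ≤ m → maximum xs + n ≤ m
maximum+-≤ n m []       []       n≤m = n≤m
maximum+-≤ n m (x ∷ xs) (p ∷ ps) n≤m =
  ≤-trans (≤-reflexive (+-distribʳ-⊔ n x (maximum xs))) (⊔-lub p (maximum+-≤ n m xs ps n≤m))

∈⇒≤sum : ∀ {c} {xs : List ℕ} → c ∈ xs → c ≤ sum xs
∈⇒≤sum {xs = x ∷ xs} (here refl) = m≤m+n x (sum xs)
∈⇒≤sum {xs = x ∷ xs} (there c∈xs) = ≤-trans (∈⇒≤sum c∈xs) (m≤n+m (sum xs) x)

-- When the leaves of complete k gs receive the entries of cs from left to right, slotMasses lists
-- the mass arriving below each bottom slot and bottomOverhead is the overhead paid by the bottom keys.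
slotMasses : List Bool → List ℕ → List ℕ
slotMasses (false ∷ gs) (c ∷ cs)     = c ∷ slotMasses gs cs
slotMasses (true ∷ gs)  (c ∷ d ∷ cs) = (c + d) ∷ slotMasses gs cs
slotMasses _            _            = []

bottomOverhead : List Bool → List ℕ → ℕ
bottomOverhead (false ∷ gs) (c ∷ cs)     = bottomOverhead gs cs
bottomOverhead (true ∷ gs)  (c ∷ d ∷ cs) = (c ⊔ d) + bottomOverhead gs cs
bottomOverhead _            _            = 0

sum-slotMasses≤sum : ∀ gs cs → sum (slotMasses gs cs) ≤ sum cs
sum-slotMasses≤sum []           cs           = z≤n
sum-slotMasses≤sum (false ∷ gs) []           = z≤n
sum-slotMasses≤sum (false ∷ gs) (c ∷ cs)     = +-monoʳ-≤ c (sum-slotMasses≤sum gs cs)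
sum-slotMasses≤sum (true ∷ gs)  []           = z≤n
sum-slotMasses≤sum (true ∷ gs)  (c ∷ [])     = z≤n
sum-slotMasses≤sum (true ∷ gs)  (c ∷ d ∷ cs) =
  ≤-trans (≤-reflexive (+-assoc c d _)) (+-monoʳ-≤ c (+-monoʳ-≤ d (sum-slotMasses≤sum gs cs)))

maximum-slotMasses≤sum : ∀ gs cs → maximum (slotMasses gs cs) ≤ sum cs
maximum-slotMasses≤sum gs cs = ≤-trans (maximum≤sum (slotMasses gs cs)) (sum-slotMasses≤sum gs cs)

bottomOverhead≤sum : ∀ gs cs → bottomOverhead gs cs ≤ sum cs
bottomOverhead≤sum []           cs           = z≤n
bottomOverhead≤sum (false ∷ gs) []           = z≤n
bottomOverhead≤sum (false ∷ gs) (c ∷ cs)     = ≤-trans (bottomOverhead≤sum gs cs) (m≤n+m (sum cs) c)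
bottomOverhead≤sum (true ∷ gs)  []           = z≤n
bottomOverhead≤sum (true ∷ gs)  (c ∷ [])     = z≤n
bottomOverhead≤sum (true ∷ gs)  (c ∷ d ∷ cs) =
  ≤-trans (+-monoˡ-≤ _ (m⊔n≤m+n c d))
          (≤-trans (≤-reflexive (+-assoc c d _)) (+-monoʳ-≤ c (+-monoʳ-≤ d (bottomOverhead≤sum gs cs))))

slotMasses-++ : ∀ gs gs′ cs cs′ → length cs ≡ leafCount gs →
  slotMasses (gs ++ gs′) (cs ++ cs′) ≡ slotMasses gs cs ++ slotMasses gs′ cs′
slotMasses-++ []           gs′ []           cs′ _ = refl
slotMasses-++ (false ∷ gs) gs′ (c ∷ cs)     cs′ e = cong (c ∷_) (slotMasses-++ gs gs′ cs cs′ (suc-injective e))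
slotMasses-++ (true ∷ gs)  gs′ (c ∷ d ∷ cs) cs′ e =
  cong ((c + d) ∷_) (slotMasses-++ gs gs′ cs cs′ (suc-injective (suc-injective e)))
slotMasses-++ (false ∷ gs) gs′ []           cs′ ()
slotMasses-++ (true ∷ gs)  gs′ []           cs′ ()
slotMasses-++ (true ∷ gs)  gs′ (c ∷ [])     cs′ ()

bottomOverhead-++ : ∀ gs gs′ cs cs′ → length cs ≡ leafCount gs →
  bottomOverhead (gs ++ gs′) (cs ++ cs′) ≡ bottomOverhead gs cs + bottomOverhead gs′ cs′
bottomOverhead-++ []           gs′ []           cs′ _ = refl
bottomOverhead-++ (false ∷ gs) gs′ (c ∷ cs)     cs′ e = bottomOverhead-++ gs gs′ cs cs′ (suc-injective e)
bottomOverhead-++ (true ∷ gs)  gs′ (c ∷ d ∷ cs) cs′ e =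
  trans (cong ((c ⊔ d) +_) (bottomOverhead-++ gs gs′ cs cs′ (suc-injective (suc-injective e))))
        (sym (+-assoc (c ⊔ d) _ _))
bottomOverhead-++ (false ∷ gs) gs′ []           cs′ ()
bottomOverhead-++ (true ∷ gs)  gs′ []           cs′ ()
bottomOverhead-++ (true ∷ gs)  gs′ (c ∷ [])     cs′ ()

⊔-+-≤-+-⊔ : ∀ {SL SR GL GR} → GL ≤ SL → GR ≤ SR → (SL ⊔ SR) + (GL + GR) ≤ (SL + SR) + (GL ⊔ GR)
⊔-+-≤-+-⊔ {SL} {SR} {GL} {GR} GL≤SL GR≤SR with ≤-total SL SR
... | inj₁ SL≤SR = begin
  (SL ⊔ SR) + (GL + GR) ≡⟨ cong (_+ (GL + GR)) (m≤n⇒m⊔n≡n SL≤SR) ⟩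
  SR + (GL + GR)        ≡⟨ +-assoc SR GL GR ⟨
  SR + GL + GR          ≡⟨ cong (_+ GR) (+-comm SR GL) ⟩
  GL + SR + GR          ≤⟨ +-mono-≤ (+-monoˡ-≤ SR GL≤SL) (m≤n⊔m GL GR) ⟩
  (SL + SR) + (GL ⊔ GR) ∎
  where open ≤-Reasoning
... | inj₂ SR≤SL = begin
  (SL ⊔ SR) + (GL + GR) ≡⟨ cong (_+ (GL + GR)) (m≥n⇒m⊔n≡m SR≤SL) ⟩
  SL + (GL + GR)        ≡⟨ cong (SL +_) (+-comm GL GR) ⟩
  SL + (GR + GL)        ≡⟨ +-assoc SL GR GL ⟨
  SL + GR + GL          ≤⟨ +-mono-≤ (+-monoʳ-≤ SL GR≤SR) (m≤m⊔n GL GR) ⟩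
  (SL + SR) + (GL ⊔ GR) ∎
  where open ≤-Reasoning

overhead-invariant-step : ∀ k {SL SR DL DR GL GR XL XR} →
  DL + SL ≤ k * SL + GL + XL → DR + SR ≤ k * SR + GR + XR → GL ≤ SL → GR ≤ SR →
  (SL ⊔ SR) + DL + DR + (SL + SR) ≤ suc k * (SL + SR) + (GL ⊔ GR) + (XL + XR)
overhead-invariant-step k {SL} {SR} {DL} {DR} {GL} {GR} {XL} {XR} invL invR GL≤SL GR≤SR = begin
  (SL ⊔ SR) + DL + DR + (SL + SR)
    ≡⟨ shuffle₁ (SL ⊔ SR) DL DR SL SR ⟩
  (SL ⊔ SR) + ((DL + SL) + (DR + SR))
    ≤⟨ +-monoʳ-≤ (SL ⊔ SR) (+-mono-≤ invL invR) ⟩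
  (SL ⊔ SR) + ((k * SL + GL + XL) + (k * SR + GR + XR))
    ≡⟨ shuffle₂ (SL ⊔ SR) k SL SR GL GR XL XR ⟩
  ((SL ⊔ SR) + (GL + GR)) + (k * (SL + SR) + (XL + XR))
    ≤⟨ +-monoˡ-≤ (k * (SL + SR) + (XL + XR)) (⊔-+-≤-+-⊔ GL≤SL GR≤SR) ⟩
  ((SL + SR) + (GL ⊔ GR)) + (k * (SL + SR) + (XL + XR))
    ≡⟨ shuffle₃ (SL + SR) (GL ⊔ GR) k (XL + XR) ⟩
  suc k * (SL + SR) + (GL ⊔ GR) + (XL + XR) ∎
  where
  open ≤-Reasoning
  shuffle₁ : ∀ m a b x y → m + a + b + (x + y) ≡ m + ((a + x) + (b + y))
  shuffle₁ = solve-∀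
  shuffle₂ : ∀ m k a b c d e f → m + ((k * a + c + e) + (k * b + d + f)) ≡ (m + (c + d)) + (k * (a + b) + (e + f))
  shuffle₂ = solve-∀
  shuffle₃ : ∀ s g k x → (s + g) + (k * s + x) ≡ suc k * s + g + x
  shuffle₃ = solve-∀

-- Each of the k levels above the bottom costs at most sum cs, up to the heaviest slot mass,
-- which ⊔-+-≤-+-⊔ carries upwards; the bottom keys pay bottomOverhead.
overhead-complete : ∀ k gs cs → length gs ≡ 2 ^ k → length cs ≡ leafCount gs →
  overhead (complete k gs) cs + sum cs ≤ k * sum cs + maximum (slotMasses gs cs) + bottomOverhead gs cs
overhead-complete zero (false ∷ []) (c ∷ []) _ _ =
  ≤-reflexive (trans (+-identityʳ c) (sym (trans (+-identityʳ (c ⊔ 0)) (⊔-identityʳ c))))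
overhead-complete zero (true ∷ []) (c ∷ d ∷ []) _ _ = ≤-reflexive bottom
  where
  bottom : ((c + 0) ⊔ (d + 0)) + 0 + 0 + (c + (d + 0)) ≡ ((c + d) ⊔ 0) + ((c ⊔ d) + 0)
  bottom rewrite +-identityʳ c | +-identityʳ d | ⊔-identityʳ (c + d) | +-identityʳ (c ⊔ d) | +-identityʳ (c ⊔ d) =
    +-comm (c ⊔ d) (c + d)
overhead-complete (suc k) gs cs length-gs length-cs = begin
  overhead (complete (suc k) gs) cs + sum cs
    ≡⟨ cong₂ _+_ overhead-split sum-split ⟩
  (sum csL ⊔ sum csR) + overhead (complete k gsL) csL + overhead (complete k gsR) csR + (sum csL + sum csR)
    ≤⟨ overhead-invariant-step k
         (overhead-complete k gsL csL eL length-csL) (overhead-complete k gsR csR eR length-csR)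
         (maximum-slotMasses≤sum gsL csL) (maximum-slotMasses≤sum gsR csR) ⟩
  suc k * (sum csL + sum csR) + (maximum (slotMasses gsL csL) ⊔ maximum (slotMasses gsR csR))
    + (bottomOverhead gsL csL + bottomOverhead gsR csR)
    ≡⟨ cong (suc k * (sum csL + sum csR) + (maximum (slotMasses gsL csL) ⊔ maximum (slotMasses gsR csR)) +_)
            bottomOverhead-split ⟨
  suc k * (sum csL + sum csR) + (maximum (slotMasses gsL csL) ⊔ maximum (slotMasses gsR csR))
    + bottomOverhead gs cs
    ≡⟨ cong₂ (λ a m → suc k * a + m + bottomOverhead gs cs) sum-split
         (trans (cong maximum masses-split) (maximum-++ (slotMasses gsL csL) (slotMasses gsR csR))) ⟨
  suc k * sum cs + maximum (slotMasses gs cs) + bottomOverhead gs cs ∎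
  where
  open ≤-Reasoning
  gsL = take (2 ^ k) gs
  gsR = drop (2 ^ k) gs
  eL = length-take-half k gs length-gs
  eR = length-drop-half k gs length-gs
  gs≡ : gs ≡ gsL ++ gsR
  gs≡ = sym (take++drop≡id (2 ^ k) gs)
  leaves : length cs ≡ leafCount gsL + leafCount gsR
  leaves = trans length-cs (leafCount-take-drop (2 ^ k) gs)
  fits : leafCount gsL ≤ length cs
  fits = ≤-trans (m≤m+n (leafCount gsL) (leafCount gsR)) (≤-reflexive (sym leaves))
  csL = take (leafCount gsL) cs
  csR = drop (leafCount gsL) cs
  length-csL : length csL ≡ leafCount gsL
  length-csL = trans (length-take (leafCount gsL) cs) (m≤n⇒m⊓n≡m fits)
  length-csR : length csR ≡ leafCount gsR
  length-csR = trans (length-drop (leafCount gsL) cs)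
                     (trans (cong (_∸ leafCount gsL) leaves) (m+n∸m≡n (leafCount gsL) (leafCount gsR)))
  cs≡ : cs ≡ csL ++ csR
  cs≡ = sym (take++drop≡id (leafCount gsL) cs)
  sum-split : sum cs ≡ sum csL + sum csR
  sum-split = trans (cong sum cs≡) (sum-++ csL csR)
  masses-split : slotMasses gs cs ≡ slotMasses gsL csL ++ slotMasses gsR csR
  masses-split = trans (cong₂ slotMasses gs≡ cs≡) (slotMasses-++ gsL gsR csL csR length-csL)
  bottomOverhead-split : bottomOverhead gs cs ≡ bottomOverhead gsL csL + bottomOverhead gsR csR
  bottomOverhead-split = trans (cong₂ bottomOverhead gs≡ cs≡) (bottomOverhead-++ gsL gsR csL csR length-csL)
  overhead-split : overhead (complete (suc k) gs) cs
    ≡ (sum csL ⊔ sum csR) + overhead (complete k gsL) csL + overhead (complete k gsR) csR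
  overhead-split = cong (λ n → (sum (take n cs) ⊔ sum (drop n cs))
                               + overhead (complete k gsL) (take n cs) + overhead (complete k gsR) (drop n cs))
                        (suc-completeSize k gsL eL)

overhead-complete≤suc-k*sum : ∀ k gs cs → length gs ≡ 2 ^ k → length cs ≡ leafCount gs →
  overhead (complete k gs) cs ≤ suc k * sum cs
overhead-complete≤suc-k*sum k gs cs length-gs length-cs = +-cancelʳ-≤ (sum cs) _ _ (begin
  overhead (complete k gs) cs + sum cs
    ≤⟨ overhead-complete k gs cs length-gs length-cs ⟩
  k * sum cs + maximum (slotMasses gs cs) + bottomOverhead gs cs
    ≤⟨ +-mono-≤ (+-monoʳ-≤ (k * sum cs) (maximum-slotMasses≤sum gs cs)) (bottomOverhead≤sum gs cs) ⟩
  k * sum cs + sum cs + sum cs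
    ≡⟨ cong (_+ sum cs) (+-comm (k * sum cs) (sum cs)) ⟩
  suc k * sum cs + sum cs ∎)
  where open ≤-Reasoning

overhead-complete≤k*sum : ∀ k gs cs → length gs ≡ 2 ^ k → length cs ≡ leafCount gs →
  maximum (slotMasses gs cs) + bottomOverhead gs cs ≤ sum cs →
  overhead (complete k gs) cs ≤ k * sum cs
overhead-complete≤k*sum k gs cs length-gs length-cs light = +-cancelʳ-≤ (sum cs) _ _ (begin
  overhead (complete k gs) cs + sum cs
    ≤⟨ overhead-complete k gs cs length-gs length-cs ⟩
  k * sum cs + maximum (slotMasses gs cs) + bottomOverhead gs cs
    ≡⟨ +-assoc (k * sum cs) _ _ ⟩
  k * sum cs + (maximum (slotMasses gs cs) + bottomOverhead gs cs)
    ≤⟨ +-monoʳ-≤ (k * sum cs) light ⟩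
  k * sum cs + sum cs ∎)
  where open ≤-Reasoning

slotPattern : ℕ → ℕ → ℕ → List Bool
slotPattern d s e = replicate d true ++ replicate s false ++ replicate e true

leafCount-replicate-true : ∀ d → leafCount (replicate d true) ≡ d + d
leafCount-replicate-true zero    = refl
leafCount-replicate-true (suc d) = cong suc (trans (cong suc (leafCount-replicate-true d)) (sym (+-suc d d)))

leafCount-replicate-false : ∀ s → leafCount (replicate s false) ≡ s
leafCount-replicate-false zero    = refl
leafCount-replicate-false (suc s) = cong suc (leafCount-replicate-false s)

pairMins : ℕ → List ℕ → ℕ
pairMins (suc d) (p ∷ q ∷ A) = p ⊓ q + pairMins d A
pairMins _       _           = 0

bottomOverhead+pairMins≤sum : ∀ d A → bottomOverhead (replicate d true) A + pairMins d A ≤ sum A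
bottomOverhead+pairMins≤sum zero    A           = z≤n
bottomOverhead+pairMins≤sum (suc d) []          = z≤n
bottomOverhead+pairMins≤sum (suc d) (p ∷ [])    = z≤n
bottomOverhead+pairMins≤sum (suc d) (p ∷ q ∷ A) = begin
  ((p ⊔ q) + X) + (p ⊓ q + P)   ≡⟨ shuffle (p ⊔ q) (p ⊓ q) X P ⟩
  (p ⊓ q + (p ⊔ q)) + (X + P)   ≤⟨ +-mono-≤ (≤-reflexive (m⊓n+m⊔n≡m+n p q)) (bottomOverhead+pairMins≤sum d A) ⟩
  (p + q) + sum A               ≡⟨ +-assoc p q (sum A) ⟩
  p + (q + sum A) ∎
  where
  open ≤-Reasoning
  X = bottomOverhead (replicate d true) A
  P = pairMins d A
  shuffle : ∀ a b x y → (a + x) + (b + y) ≡ (b + a) + (x + y)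
  shuffle = solve-∀

bottomOverhead-replicate-false : ∀ s B → bottomOverhead (replicate s false) B ≡ 0
bottomOverhead-replicate-false zero    B       = refl
bottomOverhead-replicate-false (suc s) []      = refl
bottomOverhead-replicate-false (suc s) (c ∷ B) = bottomOverhead-replicate-false s B

slotMasses-replicate-true≤ : ∀ c d A → All (_≤ c) A →
  All (_≤ c + pairMins d A) (slotMasses (replicate d true) A)
slotMasses-replicate-true≤ c zero    A           _ = []
slotMasses-replicate-true≤ c (suc d) []          _ = []
slotMasses-replicate-true≤ c (suc d) (p ∷ [])    _ = []
slotMasses-replicate-true≤ c (suc d) (p ∷ q ∷ A) (p≤c ∷ q≤c ∷ A≤c) =
  pair≤ ∷ All.map (λ m≤ → ≤-trans m≤ (+-monoʳ-≤ c (m≤n+m (pairMins d A) (p ⊓ q))))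
                  (slotMasses-replicate-true≤ c d A A≤c)
  where
  open ≤-Reasoning
  pair≤ : p + q ≤ c + (p ⊓ q + pairMins d A)
  pair≤ = begin
    p + q                      ≡⟨ m⊓n+m⊔n≡m+n p q ⟨
    p ⊓ q + (p ⊔ q)            ≤⟨ +-monoʳ-≤ (p ⊓ q) (⊔-lub p≤c q≤c) ⟩
    p ⊓ q + c                  ≡⟨ +-comm (p ⊓ q) c ⟩
    c + p ⊓ q                  ≤⟨ +-monoʳ-≤ c (m≤m+n (p ⊓ q) (pairMins d A)) ⟩
    c + (p ⊓ q + pairMins d A) ∎

slotMasses-replicate-false≤sum : ∀ s B → All (_≤ sum B) (slotMasses (replicate s false) B)
slotMasses-replicate-false≤sum zero    B       = []
slotMasses-replicate-false≤sum (suc s) []      = []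
slotMasses-replicate-false≤sum (suc s) (c ∷ B) =
  m≤m+n c (sum B) ∷ All.map (λ m≤ → ≤-trans m≤ (m≤n+m (sum B) c)) (slotMasses-replicate-false≤sum s B)

-- A filled slot weighs at most c plus the lighter of its two entries, which bottomOverhead does
-- not pay; c itself is paid for by the empty slot holding it.
maximum+bottomOverhead≤sum : ∀ {c} d s e A B C → length A ≡ d + d → length B ≡ s →
  All (_≤ c) A → All (_≤ c) C → c ∈ B →
  maximum (slotMasses (slotPattern d s e) (A ++ B ++ C)) + bottomOverhead (slotPattern d s e) (A ++ B ++ C)
    ≤ sum (A ++ B ++ C)
maximum+bottomOverhead≤sum {c} d s e A B C length-A length-B A≤c C≤c c∈B = begin
  maximum (slotMasses (slotPattern d s e) (A ++ B ++ C)) + bottomOverhead (slotPattern d s e) (A ++ B ++ C)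
    ≡⟨ cong₂ (λ ms x → maximum ms + x) masses-split bottom-split ⟩
  maximum (slotMasses Pd A ++ slotMasses Ps B ++ slotMasses Pe C) + (XA + XC)
    ≤⟨ maximum+-≤ (XA + XC) S _
         (++⁺ (All.map viaA (slotMasses-replicate-true≤ c d A A≤c))
              (++⁺ (All.map viaB (slotMasses-replicate-false≤sum s B))
                   (All.map viaC (slotMasses-replicate-true≤ c e C C≤c))))
         (+-mono-≤ XA≤ (≤-trans XC≤ (m≤n+m (sum C) (sum B)))) ⟩
  S ≡⟨ sum-split ⟨
  sum (A ++ B ++ C) ∎
  where
  open ≤-Reasoning
  Pd = replicate d true
  Ps = replicate s false
  Pe = replicate e true
  XA = bottomOverhead Pd A
  XC = bottomOverhead Pe C
  S = sum A + (sum B + sum C)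
  length-A′ : length A ≡ leafCount Pd
  length-A′ = trans length-A (sym (leafCount-replicate-true d))
  length-B′ : length B ≡ leafCount Ps
  length-B′ = trans length-B (sym (leafCount-replicate-false s))
  masses-split : slotMasses (slotPattern d s e) (A ++ B ++ C) ≡ slotMasses Pd A ++ slotMasses Ps B ++ slotMasses Pe C
  masses-split = trans (slotMasses-++ Pd (Ps ++ Pe) A (B ++ C) length-A′)
                       (cong (slotMasses Pd A ++_) (slotMasses-++ Ps Pe B C length-B′))
  bottom-split : bottomOverhead (slotPattern d s e) (A ++ B ++ C) ≡ XA + XC
  bottom-split = trans (bottomOverhead-++ Pd (Ps ++ Pe) A (B ++ C) length-A′)
                       (cong (XA +_) (trans (bottomOverhead-++ Ps Pe B C length-B′)
                                            (cong (_+ XC) (bottomOverhead-replicate-false s B))))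
  sum-split : sum (A ++ B ++ C) ≡ S
  sum-split = trans (sum-++ A (B ++ C)) (cong (sum A +_) (sum-++ B C))
  XA≤ : XA ≤ sum A
  XA≤ = bottomOverhead≤sum Pd A
  XC≤ : XC ≤ sum C
  XC≤ = bottomOverhead≤sum Pe C
  c≤ : c ≤ sum B
  c≤ = ∈⇒≤sum c∈B
  viaA : ∀ {m} → m ≤ c + pairMins d A → m + (XA + XC) ≤ S
  viaA {m} m≤ = begin
    m + (XA + XC)                   ≤⟨ +-monoˡ-≤ (XA + XC) m≤ ⟩
    c + pairMins d A + (XA + XC)    ≡⟨ shuffle c (pairMins d A) XA XC ⟩
    (XA + pairMins d A) + (c + XC)  ≤⟨ +-mono-≤ (bottomOverhead+pairMins≤sum d A) (+-mono-≤ c≤ XC≤) ⟩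
    S ∎
    where
    shuffle : ∀ c p a x → c + p + (a + x) ≡ (a + p) + (c + x)
    shuffle = solve-∀
  viaB : ∀ {m} → m ≤ sum B → m + (XA + XC) ≤ S
  viaB {m} m≤ = begin
    m + (XA + XC)  ≡⟨ shuffle m XA XC ⟩
    XA + (m + XC)  ≤⟨ +-mono-≤ XA≤ (+-mono-≤ m≤ XC≤) ⟩
    S ∎
    where
    shuffle : ∀ m a x → m + (a + x) ≡ a + (m + x)
    shuffle = solve-∀
  viaC : ∀ {m} → m ≤ c + pairMins e C → m + (XA + XC) ≤ S
  viaC {m} m≤ = begin
    m + (XA + XC)                    ≤⟨ +-monoˡ-≤ (XA + XC) m≤ ⟩
    c + pairMins e C + (XA + XC)     ≡⟨ shuffle c (pairMins e C) XA XC ⟩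
    XA + (c + (XC + pairMins e C))   ≤⟨ +-mono-≤ XA≤ (+-mono-≤ c≤ (bottomOverhead+pairMins≤sum e C)) ⟩
    S ∎
    where
    shuffle : ∀ c p a x → c + p + (a + x) ≡ a + (c + (x + p))
    shuffle = solve-∀

blockAround : ∀ r s j → 2 ≤ s → j < r + r + s →
  Σ ℕ λ d → Σ ℕ λ e → (d + e ≡ r) × (d + d ≤ j) × (j < d + d + s)
blockAround zero    s j             _   j<     = 0 , 0 , refl , z≤n , j<
blockAround (suc r) s zero          2≤s _      = 0 , suc r , refl , z≤n , ≤-trans (s≤s z≤n) 2≤s
blockAround (suc r) s (suc zero)    2≤s _      = 0 , suc r , refl , z≤n , 2≤s
blockAround (suc r) s (suc (suc j)) 2≤s 2+j< with
  blockAround r s j 2≤s (≤-pred (≤-pred (subst (3 + j ≤_) (cong (λ n → suc n + s) (+-suc r r)) 2+j<)))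
... | d , e , d+e≡r , 2d≤j , j<2d+s =
  suc d , e , cong suc d+e≡r ,
  subst (_≤ 2 + j) (cong suc (sym (+-suc d d))) (s≤s (s≤s 2d≤j)) ,
  subst (λ n → 3 + j ≤ suc n + s) (sym (+-suc d d)) (s≤s (s≤s j<2d+s))

∈-take-drop : ∀ n s xs {c : ℕ} ys → n ≤ length xs → length xs < n + s → c ∈ take s (drop n (xs ++ c ∷ ys))
∈-take-drop zero    zero    xs       ys _       ()
∈-take-drop zero    (suc s) []       ys _       _        = here refl
∈-take-drop zero    (suc s) (x ∷ xs) ys _       (s≤s lt) = there (∈-take-drop zero s xs ys z≤n lt)
∈-take-drop (suc n) s       (x ∷ xs) ys (s≤s le) (s≤s lt) = ∈-take-drop n s xs ys le lt

maximal-element : ∀ x xs → Σ ℕ λ c → (c ∈ x ∷ xs) × All (_≤ c) (x ∷ xs)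
maximal-element x xs = max x xs , attained (argmax-sel (λ y → y) x xs) , v≤max⁺ x xs (inj₁ ≤-refl) ∷ xs≤max x xs
  where
  attained : (max x xs ≡ x) ⊎ (max x xs ∈ xs) → max x xs ∈ x ∷ xs
  attained (inj₁ eq) = here eq
  attained (inj₂ c∈) = there c∈

-- Filled slots take two leaves each, so s ≥ 2 lets the block of empty slots cover any position.
heaviest-in-emptySlot : ∀ r s cs → 2 ≤ s → length cs ≡ r + r + s →
  Σ ℕ λ d → Σ ℕ λ e → (d + e ≡ r) ×
    (maximum (slotMasses (slotPattern d s e) cs) + bottomOverhead (slotPattern d s e) cs ≤ sum cs)
heaviest-in-emptySlot r s [] 2≤s length-cs
  with ≤-trans 2≤s (≤-trans (m≤n+m s (r + r)) (≤-reflexive (sym length-cs)))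
... | ()
heaviest-in-emptySlot r s cs@(x ∷ cs′) 2≤s length-cs
  with maximal-element x cs′
... | c , c∈cs , cs≤c with ∈-∃++ c∈cs
... | xs , ys , cs≡ with blockAround r s (length xs) 2≤s xs<
  where
  xs< : length xs < r + r + s
  xs< = begin-strict
    length xs                 <⟨ m<m+n (length xs) z<s ⟩
    length xs + suc (length ys) ≡⟨ length-++ xs ⟨
    length (xs ++ c ∷ ys)     ≡⟨ cong length cs≡ ⟨
    length cs                 ≡⟨ length-cs ⟩
    r + r + s ∎
    where open ≤-Reasoning
... | d , e , d+e≡r , 2d≤xs , xs<2d+s = d , e , d+e≡r , light
  where
  R = drop (d + d) cs
  A = take (d + d) cs
  B = take s R
  C = drop s R
  cs≡ABC : cs ≡ A ++ B ++ C
  cs≡ABC = sym (trans (cong (A ++_) (take++drop≡id s R)) (take++drop≡id (d + d) cs))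
  2d+s≤ : d + d + s ≤ length cs
  2d+s≤ = ≤-trans (+-monoˡ-≤ s (+-mono-≤ (m≤m+n d e) (m≤m+n d e)))
                  (≤-reflexive (trans (cong (λ n → n + n + s) d+e≡r) (sym length-cs)))
  length-A : length A ≡ d + d
  length-A = trans (length-take (d + d) cs) (m≤n⇒m⊓n≡m (m+n≤o⇒m≤o (d + d) 2d+s≤))
  length-B : length B ≡ s
  length-B = trans (length-take s R) (m≤n⇒m⊓n≡m (≤-trans
    (m+n≤o⇒m≤o∸n s (≤-trans (≤-reflexive (+-comm s (d + d))) 2d+s≤)) (≤-reflexive (sym (length-drop (d + d) cs)))))
  c∈B : c ∈ B
  c∈B = subst (λ l → c ∈ take s (drop (d + d) l)) (sym cs≡) (∈-take-drop (d + d) s xs ys 2d≤xs xs<2d+s)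
  light : maximum (slotMasses (slotPattern d s e) cs) + bottomOverhead (slotPattern d s e) cs ≤ sum cs
  light = subst (λ l → maximum (slotMasses (slotPattern d s e) l) + bottomOverhead (slotPattern d s e) l ≤ sum l)
                (sym cs≡ABC)
                (maximum+bottomOverhead≤sum d s e A B C length-A length-B
                   (take⁺ (d + d) cs≤c) (drop⁺ s (drop⁺ (d + d) cs≤c)) c∈B)

slotPattern-length : ∀ d s e {r} → d + e ≡ r → length (slotPattern d s e) ≡ r + s
slotPattern-length d s e refl = begin
  length (replicate d true ++ replicate s false ++ replicate e true)
    ≡⟨ length-++ (replicate d true) ⟩
  length (replicate d true) + length (replicate s false ++ replicate e true)
    ≡⟨ cong₂ _+_ (length-replicate d) (trans (length-++ (replicate s false))
                                             (cong₂ _+_ (length-replicate s) (length-replicate e))) ⟩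
  d + (s + e)
    ≡⟨ shuffle d s e ⟩
  d + e + s ∎
  where
  open ≡-Reasoning
  shuffle : ∀ d s e → d + (s + e) ≡ d + e + s
  shuffle = solve-∀

slotPattern-leafCount : ∀ d s e {r} → d + e ≡ r → leafCount (slotPattern d s e) ≡ r + s + r
slotPattern-leafCount d s e refl = begin
  leafCount (replicate d true ++ replicate s false ++ replicate e true)
    ≡⟨ leafCount-++ (replicate d true) _ ⟩
  leafCount (replicate d true) + leafCount (replicate s false ++ replicate e true)
    ≡⟨ cong₂ _+_ (leafCount-replicate-true d) (trans (leafCount-++ (replicate s false) _)
                   (cong₂ _+_ (leafCount-replicate-false s) (leafCount-replicate-true e))) ⟩
  (d + d) + (s + (e + e))
    ≡⟨ shuffle d s e ⟩
  (d + e) + s + (d + e) ∎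
  where
  open ≡-Reasoning
  shuffle : ∀ d s e → (d + d) + (s + (e + e)) ≡ (d + e) + s + (d + e)
  shuffle = solve-∀

binaryDecomposition : ∀ m → Σ ℕ λ k → Σ ℕ λ r → (2 ^ k + r ≡ suc m) × (r < 2 ^ k)
binaryDecomposition zero = 0 , 0 , refl , s≤s z≤n
binaryDecomposition (suc m) with binaryDecomposition m
... | k , r , 2^k+r≡1+m , r<2^k with suc r <? 2 ^ k
... | yes 1+r<2^k = k , suc r , trans (+-suc (2 ^ k) r) (cong suc 2^k+r≡1+m) , 1+r<2^k
... | no  1+r≮2^k = suc k , 0 , 2^[1+k]≡2+m , m^n>0 2 (suc k)
  where
  1+r≡2^k : suc r ≡ 2 ^ k
  1+r≡2^k = ≤-antisym r<2^k (≮⇒≥ 1+r≮2^k)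
  2^[1+k]≡2+m : 2 ^ suc k + 0 ≡ suc (suc m)
  2^[1+k]≡2+m = begin
    2 ^ suc k + 0       ≡⟨ +-identityʳ (2 ^ suc k) ⟩
    2 ^ k + (2 ^ k + 0) ≡⟨ cong (2 ^ k +_) (trans (+-identityʳ (2 ^ k)) (sym 1+r≡2^k)) ⟩
    2 ^ k + suc r       ≡⟨ +-suc (2 ^ k) r ⟩
    suc (2 ^ k + r)     ≡⟨ cong suc 2^k+r≡1+m ⟩
    suc (suc m) ∎
    where open ≡-Reasoning

lowOverheadPattern : ∀ b cs → length cs ≡ suc b →
  Σ ℕ λ k → Σ (List Bool) λ gs → (length gs ≡ 2 ^ k) × (leafCount gs ≡ suc b)
    × (overhead (complete k gs) cs ≤ sum cs * ⌊log₂ (b + 2)⌋)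
lowOverheadPattern b cs length-cs with binaryDecomposition b
... | k , r , 2^k+r≡1+b , r<2^k = choose (2 ≤? s)
  where
  s = 2 ^ k ∸ r
  r+s≡2^k : r + s ≡ 2 ^ k
  r+s≡2^k = m+[n∸m]≡n (<⇒≤ r<2^k)
  length-pattern : ∀ d e → d + e ≡ r → length (slotPattern d s e) ≡ 2 ^ k
  length-pattern d e d+e≡r = trans (slotPattern-length d s e d+e≡r) r+s≡2^k
  leafCount-pattern : ∀ d e → d + e ≡ r → leafCount (slotPattern d s e) ≡ suc b
  leafCount-pattern d e d+e≡r =
    trans (slotPattern-leafCount d s e d+e≡r) (trans (cong (_+ r) r+s≡2^k) 2^k+r≡1+b)
  fits : ∀ d e → d + e ≡ r → length cs ≡ leafCount (slotPattern d s e)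
  fits d e d+e≡r = trans length-cs (sym (leafCount-pattern d e d+e≡r))
  length-cs′ : length cs ≡ r + r + s
  length-cs′ = trans length-cs (trans (sym 2^k+r≡1+b)
                 (trans (+-comm (2 ^ k) r) (trans (cong (r +_) (sym r+s≡2^k)) (sym (+-assoc r r s)))))
  k≤log : k ≤ ⌊log₂ (b + 2)⌋
  k≤log = ≤-trans (≤-reflexive (sym (⌊log₂[2^n]⌋≡n k))) (⌊log₂⌋-mono-≤ (begin
    2 ^ k      ≤⟨ m≤m+n (2 ^ k) r ⟩
    2 ^ k + r  ≡⟨ 2^k+r≡1+b ⟩
    suc b      ≤⟨ n≤1+n (suc b) ⟩
    2 + b      ≡⟨ +-comm 2 b ⟩
    b + 2 ∎))
    where open ≤-Reasoning
  b+2≡2^[1+k] : s ≡ 1 → b + 2 ≡ 2 ^ suc k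
  b+2≡2^[1+k] s≡1 = begin
    b + 2                ≡⟨ +-comm b 2 ⟩
    suc (suc b)          ≡⟨ cong suc 2^k+r≡1+b ⟨
    suc (2 ^ k + r)      ≡⟨ +-suc (2 ^ k) r ⟨
    2 ^ k + suc r        ≡⟨ cong (λ n → 2 ^ k + (n + r)) s≡1 ⟨
    2 ^ k + (s + r)      ≡⟨ cong (2 ^ k +_) (trans (+-comm s r) (trans r+s≡2^k (sym (+-identityʳ (2 ^ k))))) ⟩
    2 ^ suc k ∎
    where open ≡-Reasoning
  Result = Σ ℕ λ k → Σ (List Bool) λ gs → (length gs ≡ 2 ^ k) × (leafCount gs ≡ suc b)
             × (overhead (complete k gs) cs ≤ sum cs * ⌊log₂ (b + 2)⌋)
  aligned : (Σ ℕ λ d → Σ ℕ λ e → (d + e ≡ r) ×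
              (maximum (slotMasses (slotPattern d s e) cs) + bottomOverhead (slotPattern d s e) cs ≤ sum cs)) →
            Result
  aligned (d , e , d+e≡r , light) =
    k , slotPattern d s e , length-pattern d e d+e≡r , leafCount-pattern d e d+e≡r ,
    ≤-trans (overhead-complete≤k*sum k _ cs (length-pattern d e d+e≡r) (fits d e d+e≡r) light)
            (≤-trans (≤-reflexive (*-comm k (sum cs))) (*-monoʳ-≤ (sum cs) k≤log))
  choose : Dec (2 ≤ s) → Result
  choose (yes 2≤s) = aligned (heaviest-in-emptySlot r s cs 2≤s length-cs′)
  choose (no 2≰s)  =
    k , slotPattern 0 s r , length-pattern 0 r refl , leafCount-pattern 0 r refl ,
    ≤-trans (overhead-complete≤suc-k*sum k _ cs (length-pattern 0 r refl) (fits 0 r refl))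
            (≤-reflexive (trans (*-comm (suc k) (sum cs)) (cong (sum cs *_) log≡1+k)))
    where
    log≡1+k : suc k ≡ ⌊log₂ (b + 2)⌋
    log≡1+k = sym (trans (cong ⌊log₂_⌋ (b+2≡2^[1+k] (≤-antisym (≤-pred (≰⇒> 2≰s)) (m<n⇒0<n∸m r<2^k))))
                         (⌊log₂[2^n]⌋≡n (suc k)))

lowOverheadOptimal : ∀ b cs → length cs ≡ suc b → (t : BST b) →
  Σ (BST b) λ T → (totalCost T ≤ totalCost t) × (overhead T cs ≤ sum cs * ⌊log₂ (b + 2)⌋)
lowOverheadOptimal b cs length-cs t with lowOverheadPattern b cs length-cs
... | k , gs , length-gs , leafCount-gs , bound = cast size (complete k gs) , optimal , small
  where
  size : completeSize k gs ≡ b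
  size = suc-injective (trans (suc-completeSize k gs length-gs) leafCount-gs)
  optimal : totalCost (cast size (complete k gs)) ≤ totalCost t
  optimal = begin
    totalCost (cast size (complete k gs))  ≡⟨ totalCost-cast size (complete k gs) ⟩
    totalCost (complete k gs)              ≤⟨ complete-optimal k gs length-gs (cast (sym size) t) ⟩
    totalCost (cast (sym size) t)          ≡⟨ totalCost-cast (sym size) t ⟩
    totalCost t ∎
    where open ≤-Reasoning
  small : overhead (cast size (complete k gs)) cs ≤ sum cs * ⌊log₂ (b + 2)⌋
  small = ≤-trans (≤-reflexive (overhead-cast size (complete k gs) cs)) bound

robustTree : ∀ xs {a b} → zeros xs ≡ a → ones xs ≡ b → (U : BST a) (T′ : BST b) →
  Σ (BST (length xs)) λ t → Σ (BST b) λ T →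
    (costWith true xs (levels t) ≡ totalCost T) × (totalCost T ≤ totalCost T′)
    × (costWith false xs (levels t) ≤ totalCost U + a * ⌊log₂ (b + 2)⌋)
robustTree xs {b = b} refl ones-xs U T′
  with lowOverheadOptimal b (gaps xs) (trans (length-gapsFrom 0 xs) (cong suc ones-xs)) T′
... | T , T≤T′ , small with merge T xs ones-xs U
... | t , cost₁ , cost₀ = t , T , cost₁ , T≤T′ , ≤-trans cost₀ (+-monoʳ-≤ (totalCost U) (begin
  overhead T (gaps xs)                       ≤⟨ small ⟩
  sum (gaps xs) * ⌊log₂ (b + 2)⌋             ≡⟨ cong (_* ⌊log₂ (b + 2)⌋) (sum-gapsFrom 0 xs) ⟩
  zeros xs * ⌊log₂ (b + 2)⌋ ∎))
  where open ≤-Reasoning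

lemma1 : ∀ (n : ℕ) (s : Vec Bool n) (a b : ℕ)
         → countScen false s ≡ a → countScen true s ≡ b
         → ∀ (optA optB : ℕ) → IsOPT a optA → IsOPT b optB
         → ∃[ t ] ((cCost s true t ≡ optB)
                   × (cCost s false t ≤ optA + a * ⌊log₂ (b + 2) ⌋))
lemma1 n s a b zeros≡a ones≡b optA optB ((U , costU) , _) ((T′ , costT′) , T′-optimal)
  with robustTree (toList s) (trans (sym (countScen≡count false s)) zeros≡a)
                             (trans (sym (countScen≡count true s)) ones≡b) U T′
... | t , T , cost₁ , T≤T′ , cost₀ =
  cast (length-toList s) t ,
  trans (cong (costWith true (toList s)) levels-t)
        (trans cost₁ (≤-antisym (≤-trans T≤T′ (≤-reflexive costT′)) (T′-optimal T))) ,
  subst (_≤ optA + a * ⌊log₂ (b + 2)⌋) (cong (costWith false (toList s)) (sym levels-t))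
        (subst (λ c → costWith false (toList s) (levels t) ≤ c + a * ⌊log₂ (b + 2)⌋) costU cost₀)
  where
  levels-t : levels (cast (length-toList s) t) ≡ levels t
  levels-t = levels-cast (length-toList s) t
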